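{- Let $k,\ell\ge1$ and let $\lambda$ be a partition with at most $\ell$ parts, all $\le k$, viewed in $\mathbb Z^\ell$. Then $$\tilde{\mathfrak g}^{(k)}_\lambda=\prod_{(i,j)\in\Delta^+_\ell\setminus\Delta^k(\lambda)}(1-L_j)^{ -1}(1-R_{ij})\,h_\lambda,$$ where $h_\gamma=h_{\gamma_1}\cdots h_{\gamma_\ell}$ for $\gamma\in\mathbb Z^\ell$. The right-hand side means the following: expand the product as a formal power series in commuting symbols $L_j,R_{ij}$, using $(1-L_j)^{ -1}=\sum_{n\ge0}L_j^n$. Then apply each monomial $\prod R_{ij}^{b_{ij}}\prod L_j^{c_j}$ to the index, giving $h_{\lambda+\sum b_{ij}(\epsilon_i-\epsilon_j)-\sum c_j\epsilon_j}$. Only finitely many terms are nonzero.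
   Context: $\Lambda$ is the ring of symmetric functions, $h_r$ the complete homogeneous functions ($h_0=1$, $h_r=0$ for $r<0$). $\epsilon_1,\dots,\epsilon_\ell$ is the standard basis of $\mathbb Z^\ell$, and $\Delta^+_\ell=\{(i,j):1\le i<j\le\ell\}$ with $(i,j)\leftrightarrow\epsilon_i-\epsilon_j$. A root ideal is $\Psi\subseteq\Delta^+_\ell$ such that $(i,j)\in\Psi$ and $i'\le i<j\le j'$ imply $(i',j')\in\Psi$. Set $h^{(m)}_i=\sum_{j=0}^i\binom{m+j-1}{j}h_{i-j}$ (zero for $i<0$), and $k_\gamma=h^{(0)}_{\gamma_1}\cdots h^{(\ell-1)}_{\gamma_\ell}$. For a root ideal $\Psi$, a multiset $M$ on $\{1,\dots,\ell\}$ with multiplicities $m_M$, and $\gamma\in\mathbb Z^\ell$, $$K(\Psi;M;\gamma)=\sum_{S\subseteq\Delta^+_\ell\setminus\Psi}\sum_{0\le a_j\le m_M(j)}(-1)^{|S|+\sum a_j}\prod_j\binom{m_M(j)}{a_j}k_{\gamma+\sum_{(i,j)\in S}(\epsilon_i-\epsilon_j)-\sum_ja_j\epsilon_j}.$$ $L(\mathcal L)$ is the multiset with $j$ of multiplicity $\#\{i:(i,j)\in\mathcal L\}$. $\Delta^k(\lambda)=\{(i,j)\in\Delta^+_\ell:\lambda_i+j-i>k\}$ and $\tilde{\mathfrak g}^{(k)}_\lambda=K(\Delta^k(\lambda);L(\Delta^k(\lambda));\lambda)$. -}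

module Defs where

open import Algebra.Bundles using (CommutativeRing)
open import Data.Bool using (Bool; true; false; if_then_else_; not)
open import Data.Nat as ℕ using (ℕ; zero; suc; _∸_; _<ᵇ_; _≡ᵇ_)
open import Data.Nat.Combinatorics using (_C_)
open import Data.Integer as ℤ using (ℤ; +_; -[1+_])
open import Data.Fin using (Fin; toℕ)
open import Data.List using (List; []; _∷_; map; foldr; concatMap; filterᵇ; allFin; upTo; length)
open import Data.Product using (_×_; _,_; proj₁; proj₂)

Pos : (ℓ : ℕ) → List (Fin ℓ × Fin ℓ)
Pos ℓ = concatMap (λ i → concatMap (λ j → if toℕ i <ᵇ toℕ j then (i , j) ∷ [] else []) (allFin ℓ)) (allFin ℓ)

inΔk : {ℓ : ℕ} → ℕ → (Fin ℓ → ℕ) → Fin ℓ × Fin ℓ → Bool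
inΔk k lam (i , j) = k <ᵇ (lam i ℕ.+ (toℕ j ∸ toℕ i))

Δk : (ℓ k : ℕ) → (Fin ℓ → ℕ) → List (Fin ℓ × Fin ℓ)
Δk ℓ k lam = filterᵇ (inΔk k lam) (Pos ℓ)

coΔk : (ℓ k : ℕ) → (Fin ℓ → ℕ) → List (Fin ℓ × Fin ℓ)
coΔk ℓ k lam = filterᵇ (λ p → not (inΔk k lam p)) (Pos ℓ)

multL : {ℓ : ℕ} → List (Fin ℓ × Fin ℓ) → Fin ℓ → ℕ
multL 𝓛 j = length (filterᵇ (λ p → toℕ (proj₂ p) ≡ᵇ toℕ j) 𝓛)

ε : {ℓ : ℕ} → Fin ℓ → Fin ℓ → ℤ
ε i t = if toℕ i ≡ᵇ toℕ t then + 1 else + 0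

addRoots : {ℓ : ℕ} → (Fin ℓ → ℤ) → List (Fin ℓ × Fin ℓ) → Fin ℓ → ℤ
addRoots γ [] t = γ t
addRoots γ ((i , j) ∷ S) t = addRoots γ S t ℤ.+ ε i t ℤ.- ε j t

subL : {ℓ : ℕ} → (Fin ℓ → ℤ) → List (Fin ℓ × ℕ) → Fin ℓ → ℤ
subL γ [] t = γ t
subL γ ((j , a) ∷ as) t = subL γ as t ℤ.- (+ a) ℤ.* ε j t

sumℕ : List ℕ → ℕ
sumℕ = foldr ℕ._+_ 0

module _ {c r} (R : CommutativeRing c r) where
  open CommutativeRing R

  ΣL : List Carrier → Carrier
  ΣL = foldr _+_ 0#

  ΠL : List Carrier → Carrier
  ΠL = foldr _*_ 1#

  nat : ℕ → Carrier
  nat zero = 0#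
  nat (suc n) = 1# + nat n

  sgn : ℕ → Carrier
  sgn zero = 1#
  sgn (suc n) = - sgn n

  sumSub : {A : Set} → List A → (List A → Carrier) → Carrier
  sumSub [] f = f []
  sumSub (x ∷ xs) f = sumSub xs f + sumSub xs (λ S → f (x ∷ S))

  sumChoices : {A B : Set} → List A → (A → List B) → (List (A × B) → Carrier) → Carrier
  sumChoices [] opts f = f []
  sumChoices (x ∷ xs) opts f =
    ΣL (map (λ b → sumChoices xs opts (λ rest → f ((x , b) ∷ rest))) (opts x))

  module _ (h : ℕ → Carrier) where
    hZ : ℤ → Carrier
    hZ (+ n) = h n
    hZ -[1+ n ] = 0#

    -- h^{(m)}_i = Σ_{j=0}^{i} binom(m+j-1, j) h_{i-j}, zero for i < 0
    -- (for m = 0, j = 0 the ℕ-truncation gives binom(0,0) = 1 = binom(-1,0))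
    hm : ℕ → ℤ → Carrier
    hm m (+ i) = ΣL (map (λ j → nat ((m ℕ.+ j ∸ 1) C j) * h (i ∸ j)) (upTo (suc i)))
    hm m -[1+ n ] = 0#

    kγ : {ℓ : ℕ} → (Fin ℓ → ℤ) → Carrier
    kγ {ℓ} γ = ΠL (map (λ t → hm (toℕ t) (γ t)) (allFin ℓ))

    hγ : {ℓ : ℕ} → (Fin ℓ → ℤ) → Carrier
    hγ {ℓ} γ = ΠL (map (λ t → hZ (γ t)) (allFin ℓ))

    -- K(Ψ; M; γ), with Ψ given by the list coΨ of its complement Δ⁺_ℓ \ Ψ
    -- and M given by its multiplicity function mM.
    Kfun : {ℓ : ℕ} → List (Fin ℓ × Fin ℓ) → (Fin ℓ → ℕ) → (Fin ℓ → ℤ) → Carrier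
    Kfun {ℓ} coΨ mM γ =
      sumSub coΨ λ S →
        sumChoices (allFin ℓ) (λ j → upTo (suc (mM j))) λ as →
          sgn (length S ℕ.+ sumℕ (map proj₂ as))
          * ΠL (map (λ p → nat (mM (proj₁ p) C proj₂ p)) as)
          * kγ (subL (addRoots γ S) as)

    gtilde : (ℓ k : ℕ) → (Fin ℓ → ℕ) → Carrier
    gtilde ℓ k lam = Kfun (coΔk ℓ k lam) (multL (Δk ℓ k lam)) (λ t → + lam t)

    -- Right-hand side, expanded: ∏_{(i,j) ∈ coΔ} (Σ_{d ≥ 0} L_j^d)(1 - R_ij) h_λ,
    -- with each exponent d_{ij} truncated to d_{ij} ≤ N.
    rhsTrunc : (ℓ k N : ℕ) → (Fin ℓ → ℕ) → Carrier
    rhsTrunc ℓ k N lam =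
      sumSub (coΔk ℓ k lam) λ S →
        sumChoices (coΔk ℓ k lam) (λ _ → upTo (suc N)) λ ds →
          sgn (length S)
          * hγ (subL (addRoots (λ t → + lam t) S) (map (λ p → proj₂ (proj₁ p) , proj₂ p) ds))

module Submission where

-- By Pascal's rule h⁽m+1⁾ satisfies (1 - L) h⁽m+1⁾ = h⁽m⁾, where L lowers the index by one;
-- equivalently h⁽m+1⁾_y = Σ_{d ≥ 0} h⁽m⁾_{y-d}. In k_γ column t has weight t, which is the number
-- of pairs (i , t) outside Δ^k(λ) plus the multiplicity of t in L(Δ^k(λ)). The binomial sums of
-- K(Ψ; M; γ) apply (1 - L_t) to column t once for each unit of the second part, leaving weight
-- #{i : (i , t) ∉ Δ^k(λ)}, and each such unit is then unfolded as a geometric series in L_t down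
-- to h = h⁽0⁾. Cutting these series at N ≥ |λ| changes nothing: the index vectors all have
-- coordinate sum |λ|, so if they are nonnegative each coordinate is at most N, and h⁽m⁾ vanishes
-- at negative indices.

open import Defs
open import Algebra.Bundles using (CommutativeRing)
open import Data.Nat using (ℕ; _≤_)
open import Data.Fin using (Fin)
open import Data.List using (map; allFin)

open import Data.Bool using (Bool; true; false; if_then_else_; not)
open import Data.Nat as ℕ using (zero; suc; _∸_; _<ᵇ_; _≡ᵇ_; s≤s)
import Data.Nat.Properties as ℕP
open import Data.Nat.Combinatorics using (_C_; nCk+nC[k+1]≡[n+1]C[k+1])
open import Data.Nat.Combinatorics.Specification using (k>n⇒nCk≡0)
open import Data.Integer as ℤ using (ℤ; +_; -[1+_])
import Data.Integer.Properties as ℤP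
open import Data.Integer.Tactic.RingSolver using (solve-∀)
open import Data.Fin as F using (toℕ) renaming (zero to fz; suc to fs)
open import Data.Fin.Properties using (suc-injective)
open import Data.List as L using (List; []; _∷_; _++_; foldr; length; filterᵇ; upTo; concatMap)
import Data.List.Properties as LP
open import Data.List.Membership.Propositional using (_∈_; _∉_)
open import Data.List.Membership.Propositional.Properties using (∈-allFin)
open import Data.List.Relation.Unary.Any using (here; there; satisfied)
open import Data.List.Relation.Unary.All as All using (All; []; _∷_)
open import Data.List.Relation.Unary.All.Properties using (¬All⇒Any¬)
import Data.List.Relation.Unary.AllPairs as AllPairs
open import Data.List.Relation.Unary.Unique.Propositional using (Unique)
open import Data.List.Relation.Unary.Unique.Propositional.Properties using (allFin⁺)
open import Data.Product using (_×_; _,_; proj₁; proj₂)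
open import Relation.Binary.PropositionalEquality
  using (_≡_; _≢_; refl; sym; trans; cong; cong₂; subst; module ≡-Reasoning)
open import Relation.Nullary using (yes; no)
open import Data.Empty using (⊥-elim)
open import Function using (_∘_; id)
import Algebra.Properties.CommutativeSemigroup as CommSemigroupProperties

map-allFin-suc : ∀ {a} {A : Set a} {n} (f : Fin (suc n) → A) →
  map f (allFin (suc n)) ≡ f fz ∷ map (f ∘ fs) (allFin n)
map-allFin-suc f = trans (LP.map-tabulate id f) (cong (f fz ∷_) (sym (LP.map-tabulate id (f ∘ fs))))

map-upTo-suc : ∀ {a} {A : Set a} n (f : ℕ → A) →
  map f (upTo (suc n)) ≡ f 0 ∷ map (f ∘ suc) (upTo n)
map-upTo-suc n f = trans (LP.map-upTo f (suc n)) (cong (f 0 ∷_) (sym (LP.map-upTo (f ∘ suc) n)))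

toℕ-≡ᵇ-refl : ∀ {ℓ} (x : Fin ℓ) → (toℕ x ≡ᵇ toℕ x) ≡ true
toℕ-≡ᵇ-refl fz = refl
toℕ-≡ᵇ-refl (fs x) = toℕ-≡ᵇ-refl x

toℕ-≡ᵇ-≢ : ∀ {ℓ} {x t : Fin ℓ} → x ≢ t → (toℕ x ≡ᵇ toℕ t) ≡ false
toℕ-≡ᵇ-≢ {x = fz} {fz} x≢t = ⊥-elim (x≢t refl)
toℕ-≡ᵇ-≢ {x = fz} {fs t} _ = refl
toℕ-≡ᵇ-≢ {x = fs x} {fz} _ = refl
toℕ-≡ᵇ-≢ {x = fs x} {fs t} x≢t = toℕ-≡ᵇ-≢ (x≢t ∘ cong fs)

lowerAt : ∀ {ℓ} → Fin ℓ → ℕ → (Fin ℓ → ℤ) → Fin ℓ → ℤ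
lowerAt x b γ t = γ t ℤ.- (+ b) ℤ.* ε x t

lowerAt-at : ∀ {ℓ} (x : Fin ℓ) b γ → lowerAt x b γ x ≡ γ x ℤ.- + b
lowerAt-at x b γ rewrite toℕ-≡ᵇ-refl x = cong (λ z → γ x ℤ.- z) (ℤP.*-identityʳ (+ b))

lowerAt-elsewhere : ∀ {ℓ} {x t : Fin ℓ} b γ → x ≢ t → lowerAt x b γ t ≡ γ t
lowerAt-elsewhere {x = x} {t} b γ x≢t rewrite toℕ-≡ᵇ-≢ x≢t =
  trans (cong (λ z → γ t ℤ.- z) (ℤP.*-zeroʳ (+ b))) (ℤP.+-identityʳ (γ t))

lowerAt-≤ : ∀ {ℓ} (x : Fin ℓ) b γ t → lowerAt x b γ t ℤ.≤ γ t
lowerAt-≤ x b γ t with x F.≟ t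
... | yes refl = subst (ℤ._≤ γ x) (sym (lowerAt-at x b γ)) (ℤP.i-j≤i (γ x) (+ b))
... | no x≢t = ℤP.≤-reflexive (lowerAt-elsewhere b γ x≢t)

subL-≤ : ∀ {ℓ} (γ : Fin ℓ → ℤ) as t → subL γ as t ℤ.≤ γ t
subL-≤ γ [] t = ℤP.≤-refl
subL-≤ γ ((j , a) ∷ as) t = ℤP.≤-trans (lowerAt-≤ j a (subL γ as) t) (subL-≤ γ as t)

subL-lowerAt : ∀ {ℓ} (γ : Fin ℓ → ℤ) as x b t → subL (lowerAt x b γ) as t ≡ lowerAt x b (subL γ as) t
subL-lowerAt γ [] x b t = refl
subL-lowerAt γ ((j , a) ∷ as) x b t =
  trans (cong (λ z → z ℤ.- (+ a) ℤ.* ε j t) (subL-lowerAt γ as x b t))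
        (swap (subL γ as t) ((+ b) ℤ.* ε x t) ((+ a) ℤ.* ε j t))
  where
  swap : ∀ y c d → (y ℤ.- c) ℤ.- d ≡ (y ℤ.- d) ℤ.- c
  swap = solve-∀

columnShifts : ∀ {ℓ} → List ((Fin ℓ × Fin ℓ) × ℕ) → List (Fin ℓ × ℕ)
columnShifts = map (λ p → proj₂ (proj₁ p) , proj₂ p)

[y-1]-d≡y-[1+d] : ∀ y d → (y ℤ.- + 1) ℤ.- + d ≡ y ℤ.- + suc d
[y-1]-d≡y-[1+d] y d = assoc y (+ d)
  where
  assoc : ∀ y e → (y ℤ.- + 1) ℤ.- e ≡ y ℤ.- (+ 1 ℤ.+ e)
  assoc = solve-∀

y≤N⇒y-[1+N]<0 : ∀ y N → y ℤ.≤ + N → y ℤ.- + suc N ℤ.< + 0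
y≤N⇒y-[1+N]<0 -[1+ n ] N _ = ℤ.-<+
y≤N⇒y-[1+N]<0 (+ i) N (ℤ.+≤+ i≤N) = subst (ℤ._< + 0) (sym (begin
    i ℤ.⊖ suc N ≡⟨ ℤP.⊖-< (s≤s i≤N) ⟩
    ℤ.- (+ (suc N ∸ i)) ≡⟨ cong (λ z → ℤ.- (+ z)) (ℕP.+-∸-assoc 1 i≤N) ⟩
    -[1+ N ∸ i ] ∎)) ℤ.-<+
  where open ≡-Reasoning

multL-++ : ∀ {ℓ} (xs ys : List (Fin ℓ × Fin ℓ)) t → multL (xs ++ ys) t ≡ multL xs t ℕ.+ multL ys t
multL-++ [] ys t = refl
multL-++ ((i , j) ∷ xs) ys t with toℕ j ≡ᵇ toℕ t
... | true = cong suc (multL-++ xs ys t)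
... | false = multL-++ xs ys t

multL-concatMap : ∀ {ℓ} {A : Set} (f : A → List (Fin ℓ × Fin ℓ)) xs t →
  multL (concatMap f xs) t ≡ sumℕ (map (λ x → multL (f x) t) xs)
multL-concatMap f [] t = refl
multL-concatMap f (x ∷ xs) t =
  trans (multL-++ (f x) (concatMap f xs) t) (cong (multL (f x) t ℕ.+_) (multL-concatMap f xs t))

multL-at : ∀ {ℓ} (i j : Fin ℓ) P → multL ((i , j) ∷ P) j ≡ suc (multL P j)
multL-at i j P rewrite toℕ-≡ᵇ-refl j = refl

multL-elsewhere : ∀ {ℓ} (i : Fin ℓ) {j t} P → j ≢ t → multL ((i , j) ∷ P) t ≡ multL P t
multL-elsewhere i P j≢t rewrite toℕ-≡ᵇ-≢ j≢t = refl

multL-filterᵇ-split : ∀ {ℓ} (q : Fin ℓ × Fin ℓ → Bool) P t →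
  multL (filterᵇ (not ∘ q) P) t ℕ.+ multL (filterᵇ q P) t ≡ multL P t
multL-filterᵇ-split q [] t = refl
multL-filterᵇ-split q ((i , j) ∷ P) t with q (i , j) | toℕ j ≡ᵇ toℕ t in e
... | true | true rewrite e = trans (ℕP.+-suc _ _) (cong suc (multL-filterᵇ-split q P t))
... | true | false rewrite e = multL-filterᵇ-split q P t
... | false | true rewrite e = cong suc (multL-filterᵇ-split q P t)
... | false | false rewrite e = multL-filterᵇ-split q P t

sumℕ-cong : ∀ {A : Set} {f g : A → ℕ} xs → (∀ x → f x ≡ g x) → sumℕ (map f xs) ≡ sumℕ (map g xs)
sumℕ-cong [] _ = refl
sumℕ-cong (x ∷ xs) f≡g = cong₂ ℕ._+_ (f≡g x) (sumℕ-cong xs f≡g)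

sumℕ-zero : ∀ {A : Set} {f : A → ℕ} xs → (∀ x → f x ≡ 0) → sumℕ (map f xs) ≡ 0
sumℕ-zero [] _ = refl
sumℕ-zero (x ∷ xs) f≡0 = cong₂ ℕ._+_ (f≡0 x) (sumℕ-zero xs f≡0)

sumℕ-allFin-point : ∀ {ℓ} (f : Fin ℓ → ℕ) t → (∀ j → t ≢ j → f j ≡ 0) → sumℕ (map f (allFin ℓ)) ≡ f t
sumℕ-allFin-point {suc n} f fz f≡0 = begin
  sumℕ (map f (allFin (suc n)))            ≡⟨ cong sumℕ (map-allFin-suc f) ⟩
  f fz ℕ.+ sumℕ (map (f ∘ fs) (allFin n))  ≡⟨ cong (f fz ℕ.+_) (sumℕ-zero (allFin n) (λ j → f≡0 (fs j) λ ())) ⟩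
  f fz ℕ.+ 0                               ≡⟨ ℕP.+-identityʳ _ ⟩
  f fz                                     ∎
  where open ≡-Reasoning
sumℕ-allFin-point {suc n} f (fs t) f≡0 = begin
  sumℕ (map f (allFin (suc n)))            ≡⟨ cong sumℕ (map-allFin-suc f) ⟩
  f fz ℕ.+ sumℕ (map (f ∘ fs) (allFin n))  ≡⟨ cong (ℕ._+ sumℕ (map (f ∘ fs) (allFin n))) (f≡0 fz λ ()) ⟩
  sumℕ (map (f ∘ fs) (allFin n))           ≡⟨ sumℕ-allFin-point (f ∘ fs) t (λ j t≢j → f≡0 (fs j) (t≢j ∘ suc-injective)) ⟩
  f (fs t)                                 ∎
  where open ≡-Reasoning

sumℕ-allFin-< : ∀ {ℓ} (t : Fin ℓ) → sumℕ (map (λ i → if toℕ i <ᵇ toℕ t then 1 else 0) (allFin ℓ)) ≡ toℕ t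
sumℕ-allFin-< {suc n} fz =
  trans (cong sumℕ (map-allFin-suc {n = n} (λ i → if toℕ i <ᵇ 0 then 1 else 0)))
        (sumℕ-zero {f = λ _ → 0} (allFin n) (λ _ → refl))
sumℕ-allFin-< {suc n} (fs t) =
  trans (cong sumℕ (map-allFin-suc {n = n} (λ i → if toℕ i <ᵇ toℕ (fs t) then 1 else 0)))
        (cong suc (sumℕ-allFin-< t))

multL-Pos : ∀ ℓ (t : Fin ℓ) → multL (Pos ℓ) t ≡ toℕ t
multL-Pos ℓ t = begin
  multL (Pos ℓ) t                                       ≡⟨ multL-concatMap _ (allFin ℓ) t ⟩
  sumℕ (map (λ i → multL (concatMap (root i) (allFin ℓ)) t) (allFin ℓ))
    ≡⟨ sumℕ-cong (allFin ℓ) (λ i → trans (multL-concatMap (root i) (allFin ℓ) t)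
                                        (sumℕ-allFin-point _ t (column-elsewhere i))) ⟩
  sumℕ (map (λ i → multL (root i t) t) (allFin ℓ))      ≡⟨ sumℕ-cong (allFin ℓ) column-at ⟩
  sumℕ (map (λ i → if toℕ i <ᵇ toℕ t then 1 else 0) (allFin ℓ)) ≡⟨ sumℕ-allFin-< t ⟩
  toℕ t ∎
  where
  open ≡-Reasoning
  root : Fin ℓ → Fin ℓ → List (Fin ℓ × Fin ℓ)
  root i j = if toℕ i <ᵇ toℕ j then (i , j) ∷ [] else []
  column-elsewhere : ∀ i j → t ≢ j → multL (root i j) t ≡ 0
  column-elsewhere i j t≢j with toℕ i <ᵇ toℕ j
  ... | true = multL-elsewhere i [] (t≢j ∘ sym)
  ... | false = refl
  column-at : ∀ i → multL (root i t) t ≡ (if toℕ i <ᵇ toℕ t then 1 else 0)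
  column-at i with toℕ i <ᵇ toℕ t
  ... | true = multL-at i t []
  ... | false = refl

toℕ≡multL-coΔk+multL-Δk : ∀ ℓ k (lam : Fin ℓ → ℕ) t →
  toℕ t ≡ multL (coΔk ℓ k lam) t ℕ.+ multL (Δk ℓ k lam) t
toℕ≡multL-coΔk+multL-Δk ℓ k lam t =
  sym (trans (multL-filterᵇ-split (inΔk k lam) (Pos ℓ) t) (multL-Pos ℓ t))

sumℤ : List ℤ → ℤ
sumℤ = foldr ℤ._+_ (+ 0)

sumℤ-map-+ : ∀ {A : Set} (f g : A → ℤ) xs →
  sumℤ (map (λ x → f x ℤ.+ g x) xs) ≡ sumℤ (map f xs) ℤ.+ sumℤ (map g xs)
sumℤ-map-+ f g [] = refl
sumℤ-map-+ f g (x ∷ xs) =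
  trans (cong (λ z → f x ℤ.+ g x ℤ.+ z) (sumℤ-map-+ f g xs)) (interchange (f x) (g x) _ _)
  where open CommSemigroupProperties ℤP.+-commutativeSemigroup using (interchange)

sumℤ-map-neg : ∀ {A : Set} (f : A → ℤ) xs → sumℤ (map (λ x → ℤ.- f x) xs) ≡ ℤ.- sumℤ (map f xs)
sumℤ-map-neg f [] = refl
sumℤ-map-neg f (x ∷ xs) =
  trans (cong (λ z → ℤ.- f x ℤ.+ z) (sumℤ-map-neg f xs)) (sym (ℤP.neg-distrib-+ (f x) _))

sumℤ-map-pos : ∀ {A : Set} (f : A → ℕ) xs → sumℤ (map (λ x → + f x) xs) ≡ + sumℕ (map f xs)
sumℤ-map-pos f [] = refl
sumℤ-map-pos f (x ∷ xs) rewrite sumℤ-map-pos f xs = refl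

sumℤ-zero : ∀ {A : Set} {f : A → ℤ} xs → (∀ x → f x ≡ + 0) → sumℤ (map f xs) ≡ + 0
sumℤ-zero [] _ = refl
sumℤ-zero (x ∷ xs) f≡0 = cong₂ ℤ._+_ (f≡0 x) (sumℤ-zero xs f≡0)

0≤sumℤ : ∀ {A : Set} (f : A → ℤ) xs → All (λ x → + 0 ℤ.≤ f x) xs → + 0 ℤ.≤ sumℤ (map f xs)
0≤sumℤ f [] [] = ℤP.≤-refl
0≤sumℤ f (x ∷ xs) (0≤fx ∷ 0≤fxs) = ℤP.+-mono-≤ 0≤fx (0≤sumℤ f xs 0≤fxs)

∈⇒≤sumℤ : ∀ {A : Set} (f : A → ℤ) xs {x} → x ∈ xs → All (λ x → + 0 ℤ.≤ f x) xs → f x ℤ.≤ sumℤ (map f xs)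
∈⇒≤sumℤ f (x ∷ xs) (here refl) (_ ∷ 0≤fxs) = ℤP.i≤i+j (f x) _ {{ℤ.nonNegative (0≤sumℤ f xs 0≤fxs)}}
∈⇒≤sumℤ f (y ∷ xs) (there x∈xs) (0≤fy ∷ 0≤fxs) =
  ℤP.≤-trans (∈⇒≤sumℤ f xs x∈xs 0≤fxs) (ℤP.i≤j+i _ (f y) {{ℤ.nonNegative 0≤fy}})

coordSum : ∀ {ℓ} → (Fin ℓ → ℤ) → ℤ
coordSum {ℓ} γ = sumℤ (map γ (allFin ℓ))

coordSum-ε : ∀ {ℓ} (i : Fin ℓ) → coordSum (ε i) ≡ + 1
coordSum-ε {suc n} fz =
  trans (cong sumℤ (map-allFin-suc (ε (fz {n})))) (cong (λ z → + 1 ℤ.+ z) (sumℤ-zero (allFin n) (λ _ → refl)))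
coordSum-ε {suc n} (fs i) =
  trans (cong sumℤ (map-allFin-suc (ε (fs i)))) (trans (ℤP.+-identityˡ _) (coordSum-ε i))

coordSum-addRoots : ∀ {ℓ} (γ : Fin ℓ → ℤ) S → coordSum (addRoots γ S) ≡ coordSum γ
coordSum-addRoots γ [] = refl
coordSum-addRoots {ℓ} γ ((i , j) ∷ S) = begin
  coordSum (λ t → addRoots γ S t ℤ.+ ε i t ℤ.- ε j t)
    ≡⟨ sumℤ-map-+ (λ t → addRoots γ S t ℤ.+ ε i t) (λ t → ℤ.- ε j t) (allFin ℓ) ⟩
  coordSum (λ t → addRoots γ S t ℤ.+ ε i t) ℤ.+ sumℤ (map (λ t → ℤ.- ε j t) (allFin ℓ))
    ≡⟨ cong₂ ℤ._+_ (sumℤ-map-+ (addRoots γ S) (ε i) (allFin ℓ)) (sumℤ-map-neg (ε j) (allFin ℓ)) ⟩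
  coordSum (addRoots γ S) ℤ.+ coordSum (ε i) ℤ.- coordSum (ε j)
    ≡⟨ cong₂ (λ a b → coordSum (addRoots γ S) ℤ.+ a ℤ.- b) (coordSum-ε i) (coordSum-ε j) ⟩
  coordSum (addRoots γ S) ℤ.+ + 1 ℤ.- + 1
    ≡⟨ cancel (coordSum (addRoots γ S)) ⟩
  coordSum (addRoots γ S)
    ≡⟨ coordSum-addRoots γ S ⟩
  coordSum γ ∎
  where
  open ≡-Reasoning
  cancel : ∀ y → y ℤ.+ + 1 ℤ.- + 1 ≡ y
  cancel = solve-∀

module _ {c r} (R : CommutativeRing c r) (h : ℕ → CommutativeRing.Carrier R) where
  open CommutativeRing R renaming (refl to ≈-refl; sym to ≈-sym; trans to ≈-trans)
  open import Relation.Binary.Reasoning.Setoid setoid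
  open import Algebra.Properties.Ring ring using (-‿distribˡ-*)
  open import Algebra.Properties.AbelianGroup +-abelianGroup using (ε⁻¹≈ε; ⁻¹-∙-comm; //-rightDividesʳ)
  open CommSemigroupProperties +-commutativeSemigroup using () renaming (interchange to +-interchange)
  open CommSemigroupProperties *-commutativeSemigroup using () renaming (interchange to *-interchange)

  ∑ : ∀ {A : Set} → List A → (A → Carrier) → Carrier
  ∑ xs f = ΣL R (map f xs)

  ∏ : ∀ {A : Set} → List A → (A → Carrier) → Carrier
  ∏ xs f = ΠL R (map f xs)

  ∑-cong : ∀ {A : Set} (xs : List A) {f g : A → Carrier} → (∀ x → f x ≈ g x) → ∑ xs f ≈ ∑ xs g
  ∑-cong [] _ = ≈-refl
  ∑-cong (x ∷ xs) f≈g = +-cong (f≈g x) (∑-cong xs f≈g)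

  ∏-cong : ∀ {A : Set} (xs : List A) {f g : A → Carrier} → (∀ x → f x ≈ g x) → ∏ xs f ≈ ∏ xs g
  ∏-cong [] _ = ≈-refl
  ∏-cong (x ∷ xs) f≈g = *-cong (f≈g x) (∏-cong xs f≈g)

  ∑-+ : ∀ {A : Set} (xs : List A) (f g : A → Carrier) → ∑ xs (λ x → f x + g x) ≈ ∑ xs f + ∑ xs g
  ∑-+ [] _ _ = ≈-sym (+-identityʳ 0#)
  ∑-+ (x ∷ xs) f g = ≈-trans (+-congˡ (∑-+ xs f g)) (+-interchange (f x) (g x) _ _)

  ∑-*ˡ : ∀ {A : Set} (xs : List A) a (f : A → Carrier) → ∑ xs (λ x → a * f x) ≈ a * ∑ xs f
  ∑-*ˡ [] a _ = ≈-sym (zeroʳ a)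
  ∑-*ˡ (x ∷ xs) a f = ≈-trans (+-congˡ (∑-*ˡ xs a f)) (≈-sym (distribˡ a (f x) _))

  ∑-*ʳ : ∀ {A : Set} (xs : List A) a (f : A → Carrier) → ∑ xs (λ x → f x * a) ≈ ∑ xs f * a
  ∑-*ʳ [] a _ = ≈-sym (zeroˡ a)
  ∑-*ʳ (x ∷ xs) a f = ≈-trans (+-congˡ (∑-*ʳ xs a f)) (≈-sym (distribʳ a (f x) _))

  ∑-neg : ∀ {A : Set} (xs : List A) (f : A → Carrier) → ∑ xs (λ x → - f x) ≈ - ∑ xs f
  ∑-neg [] _ = ≈-sym ε⁻¹≈ε
  ∑-neg (x ∷ xs) f = ≈-trans (+-congˡ (∑-neg xs f)) (⁻¹-∙-comm (f x) _)

  ∑-zero : ∀ {A : Set} (xs : List A) {f : A → Carrier} → (∀ x → f x ≈ 0#) → ∑ xs f ≈ 0#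
  ∑-zero [] _ = ≈-refl
  ∑-zero (x ∷ xs) f≈0 = ≈-trans (+-cong (f≈0 x) (∑-zero xs f≈0)) (+-identityʳ 0#)

  ∑-∷ʳ : ∀ {A : Set} (xs : List A) y (f : A → Carrier) → ∑ (xs ++ y ∷ []) f ≈ ∑ xs f + f y
  ∑-∷ʳ [] y f = ≈-trans (+-identityʳ (f y)) (≈-sym (+-identityˡ (f y)))
  ∑-∷ʳ (x ∷ xs) y f = ≈-trans (+-congˡ (∑-∷ʳ xs y f)) (≈-sym (+-assoc (f x) _ _))

  ∏-zero : ∀ {A : Set} (xs : List A) (f : A → Carrier) {x} → x ∈ xs → f x ≈ 0# → ∏ xs f ≈ 0#
  ∏-zero (y ∷ xs) f (here refl) fx≈0 = ≈-trans (*-congʳ fx≈0) (zeroˡ _)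
  ∏-zero (y ∷ xs) f (there x∈xs) fx≈0 = ≈-trans (*-congˡ (∏-zero xs f x∈xs fx≈0)) (zeroʳ _)

  sumChoices-cong : ∀ {A B : Set} (xs : List A) (opts : A → List B) {f g : List (A × B) → Carrier} →
    (∀ as → f as ≈ g as) → sumChoices R xs opts f ≈ sumChoices R xs opts g
  sumChoices-cong [] opts f≈g = f≈g []
  sumChoices-cong (x ∷ xs) opts f≈g =
    ∑-cong (opts x) (λ b → sumChoices-cong xs opts (λ as → f≈g ((x , b) ∷ as)))

  sumChoices-*ˡ : ∀ {A B : Set} (xs : List A) (opts : A → List B) a (f : List (A × B) → Carrier) →
    sumChoices R xs opts (λ as → a * f as) ≈ a * sumChoices R xs opts f
  sumChoices-*ˡ [] opts a f = ≈-refl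
  sumChoices-*ˡ (x ∷ xs) opts a f =
    ≈-trans (∑-cong (opts x) (λ b → sumChoices-*ˡ xs opts a _)) (∑-*ˡ (opts x) a _)

  sumChoices-zero : ∀ {A B : Set} (xs : List A) (opts : A → List B) {f : List (A × B) → Carrier} →
    (∀ as → f as ≈ 0#) → sumChoices R xs opts f ≈ 0#
  sumChoices-zero [] opts f≈0 = f≈0 []
  sumChoices-zero (x ∷ xs) opts f≈0 =
    ∑-zero (opts x) (λ b → sumChoices-zero xs opts (λ as → f≈0 ((x , b) ∷ as)))

  sumSub-cong : ∀ {A : Set} (xs : List A) {f g : List A → Carrier} →
    (∀ S → f S ≈ g S) → sumSub R xs f ≈ sumSub R xs g
  sumSub-cong [] f≈g = f≈g []
  sumSub-cong (x ∷ xs) f≈g = +-cong (sumSub-cong xs f≈g) (sumSub-cong xs (λ S → f≈g (x ∷ S)))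

  nat-+ : ∀ a b → nat R (a ℕ.+ b) ≈ nat R a + nat R b
  nat-+ zero b = ≈-sym (+-identityˡ _)
  nat-+ (suc a) b = ≈-trans (+-congˡ (nat-+ a b)) (≈-sym (+-assoc 1# _ _))

  nat-pascal : ∀ n k → nat R (suc n C suc k) ≈ nat R (n C k) + nat R (n C suc k)
  nat-pascal n k = ≈-trans (reflexive (cong (nat R) (sym (nCk+nC[k+1]≡[n+1]C[k+1] n k)))) (nat-+ (n C k) (n C suc k))

  nat-C-zero : ∀ n k → n ℕ.< k → nat R (n C k) ≈ 0#
  nat-C-zero n k n<k = reflexive (cong (nat R) (k>n⇒nCk≡0 n<k))

  sgn-+ : ∀ a b → sgn R (a ℕ.+ b) ≈ sgn R a * sgn R b
  sgn-+ zero b = ≈-sym (*-identityˡ _)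
  sgn-+ (suc a) b = ≈-trans (-‿cong (sgn-+ a b)) (-‿distribˡ-* (sgn R a) (sgn R b))

  h⁽_⁾ : ℕ → ℤ → Carrier
  h⁽ m ⁾ = hm R h m

  hm-zero : ∀ y → h⁽ 0 ⁾ y ≈ hZ R h y
  hm-zero -[1+ n ] = ≈-refl
  hm-zero (+ i) = begin
    h⁽ 0 ⁾ (+ i)                              ≡⟨ cong (ΣL R) (map-upTo-suc i g) ⟩
    g 0 + ∑ (upTo i) (g ∘ suc)                ≈⟨ +-cong (≈-trans (*-congʳ (+-identityʳ 1#)) (*-identityˡ _))
                                                         (∑-zero (upTo i) λ j → ≈-trans (*-congʳ (nat-C-zero j (suc j) ℕP.≤-refl)) (zeroˡ _)) ⟩
    h i + 0#                                  ≈⟨ +-identityʳ _ ⟩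
    h i ∎
    where
    g : ℕ → Carrier
    g j = nat R ((j ∸ 1) C j) * h (i ∸ j)

  hm-negative : ∀ u y → y ℤ.< + 0 → h⁽ u ⁾ y ≈ 0#
  hm-negative u -[1+ n ] _ = ≈-refl
  hm-negative u (+ n) (ℤ.+<+ ())

  hm-pascal : ∀ u y → h⁽ suc u ⁾ y ≈ h⁽ u ⁾ y + h⁽ suc u ⁾ (y ℤ.- + 1)
  hm-pascal u -[1+ n ] = ≈-sym (+-identityʳ 0#)
  hm-pascal u (+ zero) = ≈-sym (+-identityʳ _)
  hm-pascal u (+ suc i) = begin
    h⁽ suc u ⁾ (+ suc i)                              ≡⟨ cong (ΣL R) (map-upTo-suc (suc i) g) ⟩
    g 0 + ∑ (upTo (suc i)) (g ∘ suc)                  ≈⟨ +-congˡ (∑-cong (upTo (suc i)) g-suc) ⟩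
    g 0 + ∑ (upTo (suc i)) (λ j → A j + B j)          ≈⟨ +-congˡ (∑-+ (upTo (suc i)) A B) ⟩
    g 0 + (∑ (upTo (suc i)) A + ∑ (upTo (suc i)) B)   ≈⟨ ≈-sym (+-assoc _ _ _) ⟩
    (g 0 + ∑ (upTo (suc i)) A) + ∑ (upTo (suc i)) B   ≈⟨ +-congʳ (≈-sym lower-weight) ⟩
    h⁽ u ⁾ (+ suc i) + h⁽ suc u ⁾ (+ i)                ∎
    where
    g A B : ℕ → Carrier
    g j = nat R ((u ℕ.+ j) C j) * h (suc i ∸ j)
    A j = nat R ((u ℕ.+ j) C suc j) * h (i ∸ j)
    B j = nat R ((u ℕ.+ j) C j) * h (i ∸ j)
    g-suc : ∀ j → g (suc j) ≈ A j + B j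
    g-suc j = begin
      nat R ((u ℕ.+ suc j) C suc j) * h (i ∸ j)   ≡⟨ cong (λ n → nat R (n C suc j) * h (i ∸ j)) (ℕP.+-suc u j) ⟩
      nat R (suc (u ℕ.+ j) C suc j) * h (i ∸ j)   ≈⟨ *-congʳ (nat-pascal (u ℕ.+ j) j) ⟩
      (nat R ((u ℕ.+ j) C j) + nat R ((u ℕ.+ j) C suc j)) * h (i ∸ j) ≈⟨ distribʳ (h (i ∸ j)) _ _ ⟩
      B j + A j                                   ≈⟨ +-comm _ _ ⟩
      A j + B j                                   ∎
    lower-weight : h⁽ u ⁾ (+ suc i) ≈ g 0 + ∑ (upTo (suc i)) A
    lower-weight = ≈-trans (reflexive (cong (ΣL R) (map-upTo-suc (suc i) λ j → nat R ((u ℕ.+ j ∸ 1) C j) * h (suc i ∸ j))))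
      (+-congˡ (∑-cong (upTo (suc i)) λ j →
        reflexive (cong (λ n → nat R ((n ∸ 1) C suc j) * h (i ∸ j)) (ℕP.+-suc u j))))

  finiteDifference : ℕ → (ℕ → Carrier) → Carrier
  finiteDifference m g = ∑ (upTo (suc m)) (λ b → sgn R b * nat R (m C b) * g b)

  finiteDifference-cong : ∀ m {f g : ℕ → Carrier} → (∀ b → f b ≈ g b) → finiteDifference m f ≈ finiteDifference m g
  finiteDifference-cong m f≈g = ∑-cong (upTo (suc m)) (λ b → *-congˡ (f≈g b))

  finiteDifference-suc : ∀ m g → finiteDifference (suc m) g ≈ finiteDifference m g - finiteDifference m (g ∘ suc)
  finiteDifference-suc m g = begin
    finiteDifference (suc m) g                         ≡⟨ cong (ΣL R) (map-upTo-suc (suc m) t′) ⟩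
    t′ 0 + ∑ (upTo (suc m)) (t′ ∘ suc)                 ≈⟨ +-congˡ (∑-cong (upTo (suc m)) t′-suc) ⟩
    t 0 + ∑ (upTo (suc m)) (λ b → t (suc b) + - s b)   ≈⟨ +-congˡ (∑-+ (upTo (suc m)) _ _) ⟩
    t 0 + (∑ (upTo (suc m)) (t ∘ suc) + ∑ (upTo (suc m)) (λ b → - s b)) ≈⟨ ≈-sym (+-assoc _ _ _) ⟩
    (t 0 + ∑ (upTo (suc m)) (t ∘ suc)) + ∑ (upTo (suc m)) (λ b → - s b) ≈⟨ +-cong t-sum (∑-neg (upTo (suc m)) s) ⟩
    finiteDifference m g - finiteDifference m (g ∘ suc) ∎
    where
    t′ t s : ℕ → Carrier
    t′ b = sgn R b * nat R (suc m C b) * g b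
    t b = sgn R b * nat R (m C b) * g b
    s b = sgn R b * nat R (m C b) * g (suc b)
    t′-suc : ∀ b → t′ (suc b) ≈ t (suc b) + - s b
    t′-suc b = begin
      - sgn R b * nat R (suc m C suc b) * g (suc b)
        ≈⟨ *-congʳ (*-congˡ (nat-pascal m b)) ⟩
      - sgn R b * (nat R (m C b) + nat R (m C suc b)) * g (suc b)
        ≈⟨ ≈-trans (*-congʳ (distribˡ _ _ _)) (distribʳ _ _ _) ⟩
      - sgn R b * nat R (m C b) * g (suc b) + - sgn R b * nat R (m C suc b) * g (suc b)
        ≈⟨ +-comm _ _ ⟩
      t (suc b) + - sgn R b * nat R (m C b) * g (suc b)
        ≈⟨ +-congˡ (≈-trans (*-congʳ (≈-sym (-‿distribˡ-* _ _))) (≈-sym (-‿distribˡ-* _ _))) ⟩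
      t (suc b) + - s b ∎
    t-sum : t 0 + ∑ (upTo (suc m)) (t ∘ suc) ≈ finiteDifference m g
    t-sum = begin
      t 0 + ∑ (upTo (suc m)) (t ∘ suc)       ≡⟨ cong (ΣL R) (sym (map-upTo-suc (suc m) t)) ⟩
      ∑ (upTo (suc (suc m))) t               ≡⟨ cong (λ xs → ∑ xs t) (sym (LP.upTo-∷ʳ (suc m))) ⟩
      ∑ (upTo (suc m) ++ suc m ∷ []) t       ≈⟨ ∑-∷ʳ (upTo (suc m)) (suc m) t ⟩
      finiteDifference m g + t (suc m)       ≈⟨ +-congˡ (≈-trans (*-congʳ (≈-trans (*-congˡ (nat-C-zero m (suc m) ℕP.≤-refl)) (zeroʳ _))) (zeroˡ _)) ⟩
      finiteDifference m g + 0#              ≈⟨ +-identityʳ _ ⟩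
      finiteDifference m g                   ∎

  finiteDifference-hm : ∀ m v y → finiteDifference m (λ b → h⁽ v ℕ.+ m ⁾ (y ℤ.- + b)) ≈ h⁽ v ⁾ y
  finiteDifference-hm zero v y = begin
    1# * (1# + 0#) * h⁽ v ℕ.+ 0 ⁾ (y ℤ.- + 0) + 0#  ≈⟨ +-identityʳ _ ⟩
    1# * (1# + 0#) * h⁽ v ℕ.+ 0 ⁾ (y ℤ.- + 0)       ≈⟨ ≈-trans (*-congʳ (≈-trans (*-identityˡ _) (+-identityʳ 1#))) (*-identityˡ _) ⟩
    h⁽ v ℕ.+ 0 ⁾ (y ℤ.- + 0)                        ≡⟨ cong₂ h⁽_⁾ (ℕP.+-identityʳ v) (ℤP.+-identityʳ y) ⟩
    h⁽ v ⁾ y                                        ∎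
  finiteDifference-hm (suc m) v y = begin
    finiteDifference (suc m) g                     ≈⟨ finiteDifference-suc m g ⟩
    finiteDifference m g - finiteDifference m (g ∘ suc)
      ≈⟨ +-cong (finiteDifference-cong m λ b → reflexive (cong (λ n → h⁽ n ⁾ (y ℤ.- + b)) (ℕP.+-suc v m)))
                (-‿cong (finiteDifference-cong m λ b → reflexive (cong₂ h⁽_⁾ (ℕP.+-suc v m) (sym ([y-1]-d≡y-[1+d] y b))))) ⟩
    finiteDifference m (λ b → h⁽ suc v ℕ.+ m ⁾ (y ℤ.- + b))
      - finiteDifference m (λ b → h⁽ suc v ℕ.+ m ⁾ ((y ℤ.- + 1) ℤ.- + b))
      ≈⟨ +-cong (finiteDifference-hm m (suc v) y) (-‿cong (finiteDifference-hm m (suc v) (y ℤ.- + 1))) ⟩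
    h⁽ suc v ⁾ y - h⁽ suc v ⁾ (y ℤ.- + 1)          ≈⟨ +-congʳ (hm-pascal v y) ⟩
    (h⁽ v ⁾ y + h⁽ suc v ⁾ (y ℤ.- + 1)) - h⁽ suc v ⁾ (y ℤ.- + 1) ≈⟨ //-rightDividesʳ _ _ ⟩
    h⁽ v ⁾ y                                       ∎
    where
    g : ℕ → Carrier
    g b = h⁽ v ℕ.+ suc m ⁾ (y ℤ.- + b)

  hm-telescope : ∀ u n y → ∑ (upTo n) (λ d → h⁽ u ⁾ (y ℤ.- + d)) + h⁽ suc u ⁾ (y ℤ.- + n) ≈ h⁽ suc u ⁾ y
  hm-telescope u zero y = ≈-trans (+-identityˡ _) (reflexive (cong h⁽ suc u ⁾ (ℤP.+-identityʳ y)))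
  hm-telescope u (suc n) y = begin
    ∑ (upTo (suc n)) f + h⁽ suc u ⁾ (y ℤ.- + suc n)
      ≡⟨ cong (λ xs → ΣL R xs + h⁽ suc u ⁾ (y ℤ.- + suc n)) (map-upTo-suc n f) ⟩
    (f 0 + ∑ (upTo n) (f ∘ suc)) + h⁽ suc u ⁾ (y ℤ.- + suc n)
      ≈⟨ +-assoc _ _ _ ⟩
    f 0 + (∑ (upTo n) (f ∘ suc) + h⁽ suc u ⁾ (y ℤ.- + suc n))
      ≈⟨ +-congˡ (+-cong (∑-cong (upTo n) λ d → reflexive (cong h⁽ u ⁾ (sym ([y-1]-d≡y-[1+d] y d))))
                         (reflexive (cong h⁽ suc u ⁾ (sym ([y-1]-d≡y-[1+d] y n))))) ⟩
    f 0 + (∑ (upTo n) (λ d → h⁽ u ⁾ ((y ℤ.- + 1) ℤ.- + d)) + h⁽ suc u ⁾ ((y ℤ.- + 1) ℤ.- + n))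
      ≈⟨ +-congˡ (hm-telescope u n (y ℤ.- + 1)) ⟩
    f 0 + h⁽ suc u ⁾ (y ℤ.- + 1)
      ≈⟨ +-congʳ (reflexive (cong h⁽ u ⁾ (ℤP.+-identityʳ y))) ⟩
    h⁽ u ⁾ y + h⁽ suc u ⁾ (y ℤ.- + 1)
      ≈⟨ ≈-sym (hm-pascal u y) ⟩
    h⁽ suc u ⁾ y ∎
    where
    f : ℕ → Carrier
    f d = h⁽ u ⁾ (y ℤ.- + d)

  hm-geometric : ∀ u N y → y ℤ.≤ + N → ∑ (upTo (suc N)) (λ d → h⁽ u ⁾ (y ℤ.- + d)) ≈ h⁽ suc u ⁾ y
  hm-geometric u N y y≤N = begin
    ∑ (upTo (suc N)) (λ d → h⁽ u ⁾ (y ℤ.- + d))                                ≈⟨ ≈-sym (+-identityʳ _) ⟩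
    ∑ (upTo (suc N)) (λ d → h⁽ u ⁾ (y ℤ.- + d)) + 0#                           ≈⟨ +-congˡ (≈-sym (hm-negative (suc u) _ (y≤N⇒y-[1+N]<0 y N y≤N))) ⟩
    ∑ (upTo (suc N)) (λ d → h⁽ u ⁾ (y ℤ.- + d)) + h⁽ suc u ⁾ (y ℤ.- + suc N)  ≈⟨ hm-telescope u (suc N) y ⟩
    h⁽ suc u ⁾ y                                                              ∎

  kʷ : ∀ {ℓ} → (Fin ℓ → ℕ) → (Fin ℓ → ℤ) → Carrier
  kʷ {ℓ} w γ = ∏ (allFin ℓ) (λ t → h⁽ w t ⁾ (γ t))

  kʷ-cong : ∀ {ℓ} {w w′ : Fin ℓ → ℕ} {γ γ′ : Fin ℓ → ℤ} →
    (∀ t → w t ≡ w′ t) → (∀ t → γ t ≡ γ′ t) → kʷ w γ ≈ kʷ w′ γ′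
  kʷ-cong {ℓ} w≡w′ γ≡γ′ = ∏-cong (allFin ℓ) (λ t → reflexive (cong₂ h⁽_⁾ (w≡w′ t) (γ≡γ′ t)))

  ∏-allFin-suc : ∀ {n} (f : Fin (suc n) → Carrier) → ∏ (allFin (suc n)) f ≈ f fz * ∏ (allFin n) (f ∘ fs)
  ∏-allFin-suc f = reflexive (cong (ΠL R) (map-allFin-suc f))

  ∑∏-linearAt : ∀ {B : Set} (bs : List B) (c : B → Carrier) {ℓ} (x : Fin ℓ)
    (F : B → Fin ℓ → Carrier) (G : Fin ℓ → Carrier) →
    (∀ b t → x ≢ t → F b t ≈ G t) →
    ∑ bs (λ b → c b * F b x) ≈ G x →
    ∑ bs (λ b → c b * ∏ (allFin ℓ) (F b)) ≈ ∏ (allFin ℓ) G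
  ∑∏-linearAt bs c {suc n} fz F G F≈G ∑F≈G = begin
    ∑ bs (λ b → c b * ∏ (allFin (suc n)) (F b))
      ≈⟨ ∑-cong bs (λ b → *-congˡ (≈-trans (∏-allFin-suc (F b))
                                          (*-congˡ (∏-cong (allFin n) λ t → F≈G b (fs t) λ ())))) ⟩
    ∑ bs (λ b → c b * (F b fz * P))   ≈⟨ ∑-cong bs (λ b → ≈-sym (*-assoc _ _ _)) ⟩
    ∑ bs (λ b → c b * F b fz * P)     ≈⟨ ∑-*ʳ bs P (λ b → c b * F b fz) ⟩
    ∑ bs (λ b → c b * F b fz) * P     ≈⟨ *-congʳ ∑F≈G ⟩
    G fz * P                          ≈⟨ ≈-sym (∏-allFin-suc G) ⟩
    ∏ (allFin (suc n)) G              ∎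
    where
    P : Carrier
    P = ∏ (allFin n) (G ∘ fs)
  ∑∏-linearAt bs c {suc n} (fs x) F G F≈G ∑F≈G = begin
    ∑ bs (λ b → c b * ∏ (allFin (suc n)) (F b))
      ≈⟨ ∑-cong bs (λ b → *-congˡ (≈-trans (∏-allFin-suc (F b)) (*-congʳ (F≈G b fz λ ())))) ⟩
    ∑ bs (λ b → c b * (G fz * ∏ (allFin n) (F b ∘ fs)))
      ≈⟨ ∑-cong bs (λ b → ≈-trans (≈-sym (*-assoc _ _ _)) (≈-trans (*-congʳ (*-comm _ _)) (*-assoc _ _ _))) ⟩
    ∑ bs (λ b → G fz * (c b * ∏ (allFin n) (F b ∘ fs)))
      ≈⟨ ∑-*ˡ bs (G fz) _ ⟩
    G fz * ∑ bs (λ b → c b * ∏ (allFin n) (F b ∘ fs))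
      ≈⟨ *-congˡ (∑∏-linearAt bs c x (λ b → F b ∘ fs) (G ∘ fs) (λ b t x≢t → F≈G b (fs t) (x≢t ∘ suc-injective)) ∑F≈G) ⟩
    G fz * ∏ (allFin n) (G ∘ fs)
      ≈⟨ ≈-sym (∏-allFin-suc G) ⟩
    ∏ (allFin (suc n)) G ∎

  module _ {ℓ} (m : Fin ℓ → ℕ) where

    binomialTerm : (Fin ℓ → ℕ) → (Fin ℓ → ℤ) → List (Fin ℓ × ℕ) → Carrier
    binomialTerm w γ as =
      sgn R (sumℕ (map proj₂ as)) * ∏ as (λ p → nat R (m (proj₁ p) C proj₂ p)) * kʷ w (subL γ as)

    binomialSum : List (Fin ℓ) → (Fin ℓ → ℕ) → (Fin ℓ → ℤ) → Carrier
    binomialSum xs w γ = sumChoices R xs (λ j → upTo (suc (m j))) (binomialTerm w γ)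

    binomialTerm-∷ : ∀ w γ x b as →
      binomialTerm w γ ((x , b) ∷ as) ≈ (sgn R b * nat R (m x C b)) * binomialTerm w (lowerAt x b γ) as
    binomialTerm-∷ w γ x b as = begin
      sgn R (b ℕ.+ σ) * (nat R (m x C b) * π) * kʷ w (subL γ ((x , b) ∷ as))
        ≈⟨ *-congʳ (*-congʳ (sgn-+ b σ)) ⟩
      (sgn R b * sgn R σ) * (nat R (m x C b) * π) * kʷ w (subL γ ((x , b) ∷ as))
        ≈⟨ *-congʳ (*-interchange _ _ _ _) ⟩
      (sgn R b * nat R (m x C b)) * (sgn R σ * π) * kʷ w (subL γ ((x , b) ∷ as))
        ≈⟨ *-assoc _ _ _ ⟩
      (sgn R b * nat R (m x C b)) * (sgn R σ * π * kʷ w (subL γ ((x , b) ∷ as)))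
        ≈⟨ *-congˡ (*-congˡ (kʷ-cong (λ _ → refl) (λ t → sym (subL-lowerAt γ as x b t)))) ⟩
      (sgn R b * nat R (m x C b)) * binomialTerm w (lowerAt x b γ) as ∎
      where
      σ : ℕ
      σ = sumℕ (map proj₂ as)
      π : Carrier
      π = ∏ as (λ p → nat R (m (proj₁ p) C proj₂ p))

    -- Applying ∏_{j ∈ xs} (1 - L_j)^{m_j} lowers the weights by m on xs.
    binomialSum≈kʷ : ∀ xs → Unique xs → ∀ w v →
      (∀ t → t ∈ xs → w t ≡ v t ℕ.+ m t) → (∀ t → t ∉ xs → w t ≡ v t) →
      ∀ γ → binomialSum xs w γ ≈ kʷ v γ
    binomialSum≈kʷ [] _ w v _ w≡v γ =
      ≈-trans (*-congʳ (*-identityˡ 1#)) (≈-trans (*-identityˡ _) (kʷ-cong {γ = γ} (λ t → w≡v t λ ()) (λ _ → refl)))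
    binomialSum≈kʷ (x ∷ xs) (x∉xs AllPairs.∷ unique) w v w≡v+m w≡v γ = begin
      binomialSum (x ∷ xs) w γ
        ≈⟨ ∑-cong (opts x) (λ b → sumChoices-cong xs opts (binomialTerm-∷ w γ x b)) ⟩
      ∑ (opts x) (λ b → sumChoices R xs opts (λ as → coeff b * binomialTerm w (lowerAt x b γ) as))
        ≈⟨ ∑-cong (opts x) (λ b → sumChoices-*ˡ xs opts (coeff b) _) ⟩
      ∑ (opts x) (λ b → coeff b * binomialSum xs w (lowerAt x b γ))
        ≈⟨ ∑-cong (opts x) (λ b → *-congˡ (binomialSum≈kʷ xs unique w v′ w≡v′+m w≡v′ (lowerAt x b γ))) ⟩
      ∑ (opts x) (λ b → coeff b * kʷ v′ (lowerAt x b γ))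
        ≈⟨ ∑∏-linearAt (opts x) coeff x (λ b t → h⁽ v′ t ⁾ (lowerAt x b γ t)) (λ t → h⁽ v t ⁾ (γ t))
             (λ b t x≢t → reflexive (cong₂ h⁽_⁾ (v′-elsewhere x≢t) (lowerAt-elsewhere b γ x≢t)))
             (≈-trans (∑-cong (opts x) λ b → *-congˡ (reflexive (cong₂ h⁽_⁾ v′-at (lowerAt-at x b γ))))
                      (finiteDifference-hm (m x) (v x) (γ x))) ⟩
      kʷ v γ ∎
      where
      opts : Fin ℓ → List ℕ
      opts j = upTo (suc (m j))
      coeff : ℕ → Carrier
      coeff b = sgn R b * nat R (m x C b)
      v′ : Fin ℓ → ℕ
      v′ t = if toℕ x ≡ᵇ toℕ t then v t ℕ.+ m t else v t
      v′-at : v′ x ≡ v x ℕ.+ m x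
      v′-at rewrite toℕ-≡ᵇ-refl x = refl
      v′-elsewhere : ∀ {t} → x ≢ t → v′ t ≡ v t
      v′-elsewhere x≢t rewrite toℕ-≡ᵇ-≢ x≢t = refl
      w≡v′+m : ∀ t → t ∈ xs → w t ≡ v′ t ℕ.+ m t
      w≡v′+m t t∈xs =
        trans (w≡v+m t (there t∈xs)) (cong (ℕ._+ m t) (sym (v′-elsewhere (All.lookup x∉xs t∈xs))))
      w≡v′ : ∀ t → t ∉ xs → w t ≡ v′ t
      w≡v′ t t∉ with x F.≟ t
      ... | yes refl = trans (w≡v+m x (here refl)) (sym v′-at)
      ... | no x≢t = trans (w≡v t λ { (here t≡x) → x≢t (sym t≡x) ; (there t∈xs) → t∉ t∈xs })
                           (sym (v′-elsewhere x≢t))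

  geometricSum : ∀ {ℓ} → ℕ → List (Fin ℓ × Fin ℓ) → (Fin ℓ → ℕ) → (Fin ℓ → ℤ) → Carrier
  geometricSum N P w γ = sumChoices R P (λ _ → upTo (suc N)) (λ ds → kʷ w (subL γ (columnShifts ds)))

  -- Applying ∏_{(i,j) ∈ P} (1 - L_j)⁻¹ raises the weight of column j once for each (i , j) ∈ P.
  geometricSum≈kʷ : ∀ {ℓ} N (P : List (Fin ℓ × Fin ℓ)) w γ → (∀ t → γ t ℤ.≤ + N) →
    geometricSum N P w γ ≈ kʷ (λ t → w t ℕ.+ multL P t) γ
  geometricSum≈kʷ N [] w γ _ = kʷ-cong {γ = γ} (λ t → sym (ℕP.+-identityʳ (w t))) (λ _ → refl)
  geometricSum≈kʷ {ℓ} N ((i , j) ∷ P) w γ γ≤N = begin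
    geometricSum N ((i , j) ∷ P) w γ
      ≈⟨ ∑-cong (upTo (suc N)) (λ d → sumChoices-cong P (λ _ → upTo (suc N)) λ ds →
           kʷ-cong (λ _ → refl) (λ t → sym (subL-lowerAt γ (columnShifts ds) j d t))) ⟩
    ∑ (upTo (suc N)) (λ d → geometricSum N P w (lowerAt j d γ))
      ≈⟨ ∑-cong (upTo (suc N)) (λ d → ≈-trans (geometricSum≈kʷ N P w (lowerAt j d γ) (lowered≤N d))
                                              (≈-sym (*-identityˡ _))) ⟩
    ∑ (upTo (suc N)) (λ d → 1# * kʷ w′ (lowerAt j d γ))
      ≈⟨ ∑∏-linearAt (upTo (suc N)) (λ _ → 1#) j (λ d t → h⁽ w′ t ⁾ (lowerAt j d γ t))
           (λ t → h⁽ w t ℕ.+ multL ((i , j) ∷ P) t ⁾ (γ t))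
           (λ d t j≢t → reflexive (cong₂ h⁽_⁾ (cong (w t ℕ.+_) (sym (multL-elsewhere i P j≢t)))
                                              (lowerAt-elsewhere d γ j≢t)))
           column-j ⟩
    kʷ (λ t → w t ℕ.+ multL ((i , j) ∷ P) t) γ ∎
    where
    w′ : Fin ℓ → ℕ
    w′ t = w t ℕ.+ multL P t
    lowered≤N : ∀ d t → lowerAt j d γ t ℤ.≤ + N
    lowered≤N d t = ℤP.≤-trans (lowerAt-≤ j d γ t) (γ≤N t)
    column-j : ∑ (upTo (suc N)) (λ d → 1# * h⁽ w′ j ⁾ (lowerAt j d γ j)) ≈ h⁽ w j ℕ.+ multL ((i , j) ∷ P) j ⁾ (γ j)
    column-j = begin
      ∑ (upTo (suc N)) (λ d → 1# * h⁽ w′ j ⁾ (lowerAt j d γ j))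
        ≈⟨ ∑-cong (upTo (suc N)) (λ d → ≈-trans (*-identityˡ _) (reflexive (cong h⁽ w′ j ⁾ (lowerAt-at j d γ)))) ⟩
      ∑ (upTo (suc N)) (λ d → h⁽ w′ j ⁾ (γ j ℤ.- + d))  ≈⟨ hm-geometric (w′ j) N (γ j) (γ≤N j) ⟩
      h⁽ suc (w′ j) ⁾ (γ j)
        ≡⟨ cong (λ n → h⁽ n ⁾ (γ j)) (sym (trans (cong (w j ℕ.+_) (multL-at i j P)) (ℕP.+-suc (w j) _))) ⟩
      h⁽ w j ℕ.+ multL ((i , j) ∷ P) j ⁾ (γ j) ∎

  kʷ-multL≈sumChoices-hγ : ∀ {ℓ} N (P : List (Fin ℓ × Fin ℓ)) γ → coordSum γ ℤ.≤ + N →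
    kʷ (multL P) γ ≈ sumChoices R P (λ _ → upTo (suc N)) (λ ds → hγ R h (subL γ (columnShifts ds)))
  kʷ-multL≈sumChoices-hγ {ℓ} N P γ Σγ≤N with All.all? (λ t → + 0 ℤ.≤? γ t) (allFin ℓ)
  ... | yes 0≤γ = ≈-sym (begin
    sumChoices R P (λ _ → upTo (suc N)) (λ ds → hγ R h (subL γ (columnShifts ds)))
      ≈⟨ sumChoices-cong P (λ _ → upTo (suc N)) (λ ds → ∏-cong (allFin ℓ) λ t → ≈-sym (hm-zero (subL γ (columnShifts ds) t))) ⟩
    geometricSum N P (λ _ → 0) γ
      ≈⟨ geometricSum≈kʷ N P (λ _ → 0) γ (λ t → ℤP.≤-trans (∈⇒≤sumℤ γ (allFin ℓ) (∈-allFin t) 0≤γ) Σγ≤N) ⟩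
    kʷ (multL P) γ ∎)
  ... | no ¬0≤γ with satisfied (¬All⇒Any¬ (λ t → + 0 ℤ.≤? γ t) (allFin ℓ) ¬0≤γ)
  ... | t , γt≱0 = ≈-trans (∏-zero (allFin ℓ) _ (∈-allFin t) (hm-negative _ _ γt<0)) (≈-sym
        (sumChoices-zero P (λ _ → upTo (suc N)) λ ds → ∏-zero (allFin ℓ) _ (∈-allFin t)
          (≈-trans (≈-sym (hm-zero (subL γ (columnShifts ds) t))) (hm-negative 0 _ (ℤP.≤-<-trans (subL-≤ γ (columnShifts ds) t) γt<0)))))
    where
    γt<0 : γ t ℤ.< + 0
    γt<0 = ℤP.≰⇒> γt≱0

  Kfun≈geometricExpansion : ∀ {ℓ} N (P : List (Fin ℓ × Fin ℓ)) (mM : Fin ℓ → ℕ) γ →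
    (∀ t → toℕ t ≡ multL P t ℕ.+ mM t) → coordSum γ ℤ.≤ + N →
    Kfun R h P mM γ ≈ sumSub R P (λ S → sumChoices R P (λ _ → upTo (suc N)) λ ds →
                        sgn R (length S) * hγ R h (subL (addRoots γ S) (columnShifts ds)))
  Kfun≈geometricExpansion {ℓ} N P mM γ toℕ≡P+mM Σγ≤N = sumSub-cong P λ S → begin
    sumChoices R (allFin ℓ) opts (λ as →
      sgn R (length S ℕ.+ sumℕ (map proj₂ as)) * ∏ as (λ p → nat R (mM (proj₁ p) C proj₂ p))
        * kʷ toℕ (subL (addRoots γ S) as))
      ≈⟨ sumChoices-cong (allFin ℓ) opts (λ as → ≈-trans (*-congʳ (*-congʳ (sgn-+ (length S) _)))
                                                  (≈-trans (*-congʳ (*-assoc _ _ _)) (*-assoc _ _ _))) ⟩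
    sumChoices R (allFin ℓ) opts (λ as → sgn R (length S) * binomialTerm mM toℕ (addRoots γ S) as)
      ≈⟨ sumChoices-*ˡ (allFin ℓ) opts (sgn R (length S)) _ ⟩
    sgn R (length S) * binomialSum mM (allFin ℓ) toℕ (addRoots γ S)
      ≈⟨ *-congˡ (binomialSum≈kʷ mM (allFin ℓ) (allFin⁺ ℓ) toℕ (multL P)
                   (λ t _ → toℕ≡P+mM t) (λ t t∉ → ⊥-elim (t∉ (∈-allFin t))) (addRoots γ S)) ⟩
    sgn R (length S) * kʷ (multL P) (addRoots γ S)
      ≈⟨ *-congˡ (kʷ-multL≈sumChoices-hγ N P (addRoots γ S)
                   (subst (ℤ._≤ + N) (sym (coordSum-addRoots γ S)) Σγ≤N)) ⟩
    sgn R (length S) * sumChoices R P (λ _ → upTo (suc N)) (λ ds → hγ R h (subL (addRoots γ S) (columnShifts ds)))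
      ≈⟨ ≈-sym (sumChoices-*ˡ P (λ _ → upTo (suc N)) (sgn R (length S)) _) ⟩
    sumChoices R P (λ _ → upTo (suc N)) (λ ds → sgn R (length S) * hγ R h (subL (addRoots γ S) (columnShifts ds))) ∎
    where
    opts : Fin ℓ → List ℕ
    opts j = upTo (suc (mM j))

-- None of h 0 ≈ 1, k ≥ 1, ℓ ≥ 1 or the partition conditions on λ is needed: only N ≥ |λ| is used.
proposition2p11 : ∀ {c r} (R : CommutativeRing c r) (h : ℕ → CommutativeRing.Carrier R) →
    CommutativeRing._≈_ R (h 0) (CommutativeRing.1# R) →
    (k ℓ : ℕ) → 1 ≤ k → 1 ≤ ℓ →
    (lam : Fin ℓ → ℕ) →
    (∀ i j → i Data.Fin.≤ j → lam j ≤ lam i) →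
    (∀ i → lam i ≤ k) →
    (N : ℕ) → sumℕ (map lam (allFin ℓ)) ≤ N →
    CommutativeRing._≈_ R (gtilde R h ℓ k lam) (rhsTrunc R h ℓ k N lam)
proposition2p11 R h _ k ℓ _ _ lam _ _ N |λ|≤N =
  Kfun≈geometricExpansion R h N (coΔk ℓ k lam) (multL (Δk ℓ k lam)) (λ t → + lam t)
    (toℕ≡multL-coΔk+multL-Δk ℓ k lam)
    (subst (ℤ._≤ + N) (sym (sumℤ-map-pos lam (allFin ℓ))) (ℤ.+≤+ |λ|≤N))
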